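{- Let $M$ be a matroid on a ground set $E$ of size $n$. In the expansion of $F(M,\mathbf{x})$ in the basis $\{L_\alpha\}$ (respectively $\{M_\alpha\}$) of quasisymmetric functions, the coefficient of $L_{(n)}$ (respectively $M_{(n)}$) equals $1$ if $M$ splits completely, and $0$ otherwise.
   Context: For a matroid $M$ on finite ground set $E$ with bases $\mathcal{B}(M)$ and $f:E\to\mathbb{P}=\{1,2,\ldots\}$, $f$ is $M$-generic if the minimum of $f(B)=\sum_{e\in B}f(e)$ over bases is attained by a unique base; $F(M,\mathbf{x})=\sum_{f\ M\text{ -generic}}\prod_{e\in E}x_{f(e)}$. For a composition $\alpha=(\alpha_1,\ldots,\alpha_k)$, $M_\alpha=\sum_{i_1<\cdots<i_k}x_{i_1}^{\alpha_1}\cdots x_{i_k}^{\alpha_k}$ and $L_\alpha=\sum_{\beta \text{ refining }\alpha}M_\beta$ ($\beta$ refines $\alpha$ if $\alpha$ is obtained from $\beta$ by adding consecutive parts). A matroid splits completely if it is a direct sum of loops and isthmuses, equivalently if it has exactly one base. -}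

module Defs where

open import Data.Nat using (ℕ; zero; suc; _+_; _<_; _<?_)
open import Data.Integer as ℤ using (ℤ; +_; -_)
open import Data.Bool using (Bool; true; false; if_then_else_)
open import Data.Fin using (Fin; toℕ)
import Data.Fin.Properties as FinP
open import Data.Fin.Subset using (Subset; _∈_; _∉_; inside; outside)
open import Data.Vec using (Vec; []; _∷_; lookup; _[_]≔_; tabulate)
open import Data.Vec.Properties using (≡-dec)
import Data.Bool.Properties as BoolP
import Data.Nat.Properties as NatP
open import Data.List using (List; []; _∷_; map; concatMap; allFin; filter; length; foldr)
open import Data.Nat.ListAction using (sum)
open import Data.List.Relation.Unary.All using (All; all?)
open import Data.List.Relation.Unary.Any using (Any; any?)
open import Data.Product using (Σ; ∃; _×_; _,_; proj₁; proj₂)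
open import Data.Sum using (_⊎_)
open import Relation.Nullary using (Dec; ¬_)
open import Relation.Nullary.Decidable using (_×-dec_; _⊎-dec_)
open import Relation.Binary.PropositionalEquality using (_≡_)

record Matroid (n : ℕ) : Set₁ where
  field
    IsBase   : Subset n → Set
    isBase?  : (B : Subset n) → Dec (IsBase B)
    base-exists : ∃ IsBase
    exchange : ∀ {B₁ B₂} → IsBase B₁ → IsBase B₂ → ∀ x → x ∈ B₁ → x ∉ B₂ →
               ∃ λ y → y ∈ B₂ × y ∉ B₁ × IsBase ((B₁ [ x ]≔ outside) [ y ]≔ inside)
open Matroid public

-- M splits completely  ⇔  M has exactly one base (given equivalent definition).
SplitsCompletely : ∀ {n} → Matroid n → Set
SplitsCompletely M = ∀ B B′ → IsBase M B → IsBase M B′ → B ≡ B′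

allVecs : ∀ {A : Set} → List A → (n : ℕ) → List (Vec A n)
allVecs xs zero = [] ∷ []
allVecs xs (suc n) = concatMap (λ v → map (λ a → a ∷ v) xs) (allVecs xs n)

allSubsets : (n : ℕ) → List (Subset n)
allSubsets = allVecs (false ∷ true ∷ [])

bases : ∀ {n} → Matroid n → List (Subset n)
bases M = filter (isBase? M) (allSubsets _)

-- A function f : E → {1,…,k} ⊆ ℙ is encoded as g : Vec (Fin k) n with f(e) = toℕ (g e) + 1.
value : ∀ {n k} → Vec (Fin k) n → Fin n → ℕ
value g e = suc (toℕ (lookup g e))

weight : ∀ {n k} → Vec (Fin k) n → Subset n → ℕ
weight {n} g B = sum (map (λ e → if lookup B e then value g e else 0) (allFin n))

IsGeneric : ∀ {n k} → Matroid n → Vec (Fin k) n → Set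
IsGeneric M g = Any (λ B → All (λ B′ → B′ ≡ B ⊎ weight g B < weight g B′) (bases M)) (bases M)

isGeneric? : ∀ {n k} (M : Matroid n) (g : Vec (Fin k) n) → Dec (IsGeneric M g)
isGeneric? M g = any? (λ B → all? (λ B′ → ≡-dec BoolP._≟_ B′ B ⊎-dec (weight g B <? weight g B′)) (bases M)) (bases M)

-- content: i ↦ |f⁻¹(i+1)|
content : ∀ {n k} → Vec (Fin k) n → Vec ℕ k
content {n} g = tabulate (λ i → length (filter (λ e → lookup g e FinP.≟ i) (allFin n)))

-- Coefficient of the monomial x₁^{a₁} ⋯ x_k^{a_k} in F(M,x) = Σ_{f generic} Π_e x_{f(e)}:
-- the number of M-generic f with |f⁻¹(i)| = aᵢ (such f take values in {1,…,k}).
monoCoeff : ∀ {n k} → Matroid n → Vec ℕ k → ℕ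
monoCoeff {n} {k} M a =
  length (filter (λ g → ≡-dec NatP._≟_ (content g) a ×-dec isGeneric? M g) (allVecs (allFin k) n))

toVec : (xs : List ℕ) → Vec ℕ (length xs)
toVec [] = []
toVec (x ∷ xs) = x ∷ toVec xs

-- Compositions are lists of positive integers.
-- Coefficient of M_α in the monomial-quasisymmetric expansion of F(M,x):
-- equals the coefficient of x₁^{α₁} ⋯ x_k^{α_k}.
coeffM : ∀ {n} → Matroid n → List ℕ → ℕ
coeffM M α = monoCoeff M (toVec α)

-- coarsenings β of α (α refines β), paired with the number of merges ℓ(α) − ℓ(β)
coarsenings : List ℕ → List (List ℕ × ℕ)
coarsenings [] = ([] , 0) ∷ []
coarsenings (a ∷ []) = ((a ∷ []) , 0) ∷ []
coarsenings (a ∷ b ∷ rest) = concatMap step (coarsenings (b ∷ rest))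
  where
  step : List ℕ × ℕ → List (List ℕ × ℕ)
  step ([] , m) = ((a ∷ []) , m) ∷ []
  step ((c ∷ cs) , m) = ((a ∷ c ∷ cs) , m) ∷ ((a + c ∷ cs) , suc m) ∷ []

sign : ℕ → ℤ
sign zero = + 1
sign (suc m) = - sign m

-- Coefficient of L_α in the fundamental-quasisymmetric expansion of F(M,x).
-- Since L_β = Σ_{γ refines β} M_γ, Möbius inversion gives
--   [L_α] F = Σ_{β : α refines β} (−1)^{ℓ(α)−ℓ(β)} [M_β] F.
coeffL : ∀ {n} → Matroid n → List ℕ → ℤ
coeffL M α = foldr ℤ._+_ (+ 0) (map (λ p → sign (proj₂ p) ℤ.* + coeffM M (proj₁ p)) (coarsenings α))

{-# OPTIONS --safe #-}
module Submission where

-- The monomial x₁ⁿ arises only from the constant function f ≡ 1, so [M_(n)] F is 1 or 0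
-- according as f ≡ 1 is generic, and (n) has no proper coarsening, so [L_(n)] F = [M_(n)] F.
-- Under f ≡ 1 a base weighs its cardinality. If M has bases B ≠ B′, the exchange axiom yields
-- a base B − x + y ≠ B of the same cardinality (B ⊆ B′ is impossible, as exchanging from B′
-- towards B would then fail), so no base is the strict minimum. With a single base every f is
-- generic.

open import Defs
open import Data.Nat using (ℕ; zero; suc; _<_)
open import Data.Nat.Properties using (suc-injective; <-irrefl)
import Data.Nat.Properties as ℕₚ
open import Data.Integer using (+_)
open import Data.Integer.Properties using (+-identityʳ; *-identityˡ)
open import Data.Bool using (true; false; if_then_else_)
import Data.Bool.Properties as Bool
open import Data.Fin using (Fin)
import Data.Fin as Fin
open import Data.Fin.Properties using (any?)
open import Data.Fin.Subset using (Subset; _∈_; _∉_; _⊆_; inside; outside; ∣_∣)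
open import Data.Fin.Subset.Properties using (_∈?_; ⊆-antisym)
open import Data.Vec using (Vec; []; _∷_; _[_]≔_; _[_]=_; lookup; replicate; here; there)
open import Data.Vec.Properties using (≡-dec; []≔-updates; []≔-minimal; []≔-commutes)
open import Data.List using (List; []; _∷_; filter; length; map; tabulate; allFin)
open import Data.Nat.ListAction using (sum)
open import Data.List.Properties using (filter-accept; filter-reject; filter-all; length-tabulate; map-tabulate)
open import Data.List.Relation.Unary.All as All using (All)
open import Data.List.Relation.Unary.Any using (here; there)
open import Data.List.Membership.Propositional using (lose; find) renaming (_∈_ to _∈ˡ_)
open import Data.List.Membership.Propositional.Properties using (∈-concatMap⁺; ∈-map⁺; ∈-filter⁺; ∈-filter⁻)
open import Data.Product using (∃₂; _×_; _,_; proj₂)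
open import Data.Sum using (_⊎_; inj₁; inj₂)
open import Function using (_∘_)
open import Relation.Nullary using (Dec; ¬_; yes; no; contradiction; ¬?)
open import Relation.Nullary.Decidable using (_×-dec_)
open import Relation.Binary.PropositionalEquality using (_≡_; _≢_; refl; sym; trans; cong; subst; module ≡-Reasoning)

∈-allVecs : ∀ {A : Set} {xs : List A} → (∀ a → a ∈ˡ xs) → ∀ {n} (v : Vec A n) → v ∈ˡ allVecs xs n
∈-allVecs complete []      = here refl
∈-allVecs {xs = xs} complete (a ∷ v) =
  ∈-concatMap⁺ (λ w → map (_∷ w) xs) (lose (∈-allVecs complete v) (∈-map⁺ (_∷ v) (complete a)))

∈-allSubsets : ∀ {n} (B : Subset n) → B ∈ˡ allSubsets n
∈-allSubsets = ∈-allVecs λ { false → here refl ; true → there (here refl) }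

∈-bases⁺ : ∀ {n} (M : Matroid n) {B} → IsBase M B → B ∈ˡ bases M
∈-bases⁺ M {B} = ∈-filter⁺ (isBase? M) (∈-allSubsets B)

∈-bases⁻ : ∀ {n} (M : Matroid n) {B} → B ∈ˡ bases M → IsBase M B
∈-bases⁻ M = proj₂ ∘ ∈-filter⁻ (isBase? M) {xs = allSubsets _}

allVecs-singleton : ∀ {A : Set} (a : A) n → allVecs (a ∷ []) n ≡ replicate n a ∷ []
allVecs-singleton a zero    = refl
allVecs-singleton a (suc n) rewrite allVecs-singleton a n = refl

∣[]≔inside∣ : ∀ {n} {p : Subset n} {x} → x ∉ p → ∣ p [ x ]≔ inside ∣ ≡ suc ∣ p ∣
∣[]≔inside∣ {p = outside ∷ p} {Fin.zero}  x∉p = refl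
∣[]≔inside∣ {p = inside ∷ p}  {Fin.zero}  x∉p = contradiction here x∉p
∣[]≔inside∣ {p = outside ∷ p} {Fin.suc x} x∉p = ∣[]≔inside∣ (x∉p ∘ there)
∣[]≔inside∣ {p = inside ∷ p}  {Fin.suc x} x∉p = cong suc (∣[]≔inside∣ (x∉p ∘ there))

suc∣[]≔outside∣ : ∀ {n} {p : Subset n} {x} → x ∈ p → suc ∣ p [ x ]≔ outside ∣ ≡ ∣ p ∣
suc∣[]≔outside∣ here                        = refl
suc∣[]≔outside∣ (there {y = outside} x∈p) = suc∣[]≔outside∣ x∈p
suc∣[]≔outside∣ (there {y = inside} x∈p)  = cong suc (suc∣[]≔outside∣ x∈p)

exchanged : ∀ {n} → Subset n → Fin n → Fin n → Subset n
exchanged B x y = (B [ x ]≔ outside) [ y ]≔ inside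

module _ {n} {p : Subset n} {x y : Fin n} where

  ∣exchanged∣ : x ∈ p → y ∉ p → ∣ exchanged p x y ∣ ≡ ∣ p ∣
  ∣exchanged∣ x∈p y∉p = suc-injective (begin
    suc ∣ exchanged p x y ∣                      ≡⟨ cong (suc ∘ ∣_∣) ([]≔-commutes p x y x≢y) ⟩
    suc ∣ (p [ y ]≔ inside) [ x ]≔ outside ∣     ≡⟨ suc∣[]≔outside∣ ([]≔-minimal p x y x≢y x∈p) ⟩
    ∣ p [ y ]≔ inside ∣                          ≡⟨ ∣[]≔inside∣ y∉p ⟩
    suc ∣ p ∣                                    ∎)
    where
    open ≡-Reasoning
    x≢y : x ≢ y
    x≢y refl = y∉p x∈p

  exchanged-≢ : y ∉ p → exchanged p x y ≢ p
  exchanged-≢ y∉p eq = y∉p (subst (_[ y ]= inside) eq ([]≔-updates (p [ x ]≔ outside) y))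

weight-Fin1 : ∀ {n} (g : Vec (Fin 1) n) (B : Subset n) → weight g B ≡ ∣ B ∣
weight-Fin1 {n} g B = trans (cong sum (map-tabulate {n = n} (λ e → e) indicator)) (sum-indicator g B)
  where
  indicator : Fin n → ℕ
  indicator e = if lookup B e then value g e else 0

  sum-indicator : ∀ {m} (h : Vec (Fin 1) m) (C : Subset m) →
                  sum (tabulate (λ e → if lookup C e then value h e else 0)) ≡ ∣ C ∣
  sum-indicator []             []            = refl
  sum-indicator (Fin.zero ∷ h) (outside ∷ C) = sum-indicator h C
  sum-indicator (Fin.zero ∷ h) (inside ∷ C)  = cong suc (sum-indicator h C)

module _ {n} (M : Matroid n) where

  base-⊆⇒≡ : ∀ {B B′} → IsBase M B → IsBase M B′ → B ⊆ B′ → B ≡ B′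
  base-⊆⇒≡ {B} {B′} bB bB′ B⊆B′ = ⊆-antisym B⊆B′ B′⊆B
    where
    B′⊆B : B′ ⊆ B
    B′⊆B {x} x∈B′ with x ∈? B
    ... | yes x∈B = x∈B
    ... | no x∉B  with exchange M bB′ bB x x∈B′ x∉B
    ...   | y , y∈B , y∉B′ , _ = contradiction (B⊆B′ y∈B) y∉B′

  exchange-neighbour : ∀ {B B′} → IsBase M B → IsBase M B′ → B ≢ B′ →
                       ∃₂ λ x y → x ∈ B × y ∉ B × IsBase M (exchanged B x y)
  exchange-neighbour {B} {B′} bB bB′ B≢B′ with any? (λ x → x ∈? B ×-dec ¬? (x ∈? B′))
  ... | yes (x , x∈B , x∉B′) with exchange M bB bB′ x x∈B x∉B′
  ...   | y , _ , y∉B , bN = x , y , x∈B , y∉B , bN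
  exchange-neighbour {B} {B′} bB bB′ B≢B′ | no ∄x = contradiction (base-⊆⇒≡ bB bB′ B⊆B′) B≢B′
    where
    B⊆B′ : B ⊆ B′
    B⊆B′ {x} x∈B with x ∈? B′
    ... | yes x∈B′ = x∈B′
    ... | no x∉B′  = contradiction (x , x∈B , x∉B′) ∄x

  splitsCompletely⇒isGeneric : SplitsCompletely M → ∀ {k} (g : Vec (Fin k) n) → IsGeneric M g
  splitsCompletely⇒isGeneric split g with base-exists M
  ... | B , bB = lose (∈-bases⁺ M bB) (All.tabulate λ B′∈ → inj₁ (split _ B (∈-bases⁻ M B′∈) bB))

  StrictMinimiser : ∀ {k} → Vec (Fin k) n → Subset n → Set
  StrictMinimiser g B = All (λ B′ → B′ ≡ B ⊎ weight g B < weight g B′) (bases M)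

  strictMinimiser-Fin1-unique : ∀ (g : Vec (Fin 1) n) {B B′} → IsBase M B → StrictMinimiser g B →
                                IsBase M B′ → B′ ≡ B
  strictMinimiser-Fin1-unique g {B} {B′} bB minimal bB′ with ≡-dec Bool._≟_ B′ B
  ... | yes B′≡B = B′≡B
  ... | no B′≢B with exchange-neighbour bB bB′ (B′≢B ∘ sym)
  ...   | x , y , x∈B , y∉B , bN with All.lookup minimal (∈-bases⁺ M bN)
  ...     | inj₁ N≡B = contradiction N≡B (exchanged-≢ y∉B)
  ...     | inj₂ B<N = contradiction B<N (<-irrefl (sym equal-weight))
    where
    equal-weight : weight g (exchanged B x y) ≡ weight g B
    equal-weight = trans (weight-Fin1 g (exchanged B x y))
                         (trans (∣exchanged∣ x∈B y∉B) (sym (weight-Fin1 g B)))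

  isGeneric-Fin1⇒splitsCompletely : (g : Vec (Fin 1) n) → IsGeneric M g → SplitsCompletely M
  isGeneric-Fin1⇒splitsCompletely g generic B₁ B₂ bB₁ bB₂ with find generic
  ... | B , B∈ , minimal = trans (unique bB₁) (sym (unique bB₂))
    where
    unique : ∀ {B′} → IsBase M B′ → B′ ≡ B
    unique = strictMinimiser-Fin1-unique g (∈-bases⁻ M B∈) minimal

content-Fin1 : ∀ {n} (g : Vec (Fin 1) n) → content g ≡ n ∷ []
content-Fin1 {n} g = cong (_∷ []) (begin
  length (filter (λ e → lookup g e Fin.≟ Fin.zero) (allFin n))
    ≡⟨ cong length (filter-all _ {xs = allFin n} (All.tabulate (λ _ → Fin1-≡zero _))) ⟩
  length (allFin n)
    ≡⟨ length-tabulate (λ e → e) ⟩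
  n ∎)
  where
  open ≡-Reasoning
  Fin1-≡zero : (i : Fin 1) → i ≡ Fin.zero
  Fin1-≡zero Fin.zero = refl

-- Encodes the constant function f ≡ 1.
ones : ∀ {n} → Vec (Fin 1) n
ones {n} = replicate n Fin.zero

module _ {n} (M : Matroid n) where

  private
    generic-with-content-[n]? : (g : Vec (Fin 1) n) → Dec (content g ≡ n ∷ [] × IsGeneric M g)
    generic-with-content-[n]? g = ≡-dec ℕₚ._≟_ (content g) (n ∷ []) ×-dec isGeneric? M g

    coeffM-[n]≡filter-ones : coeffM M (n ∷ []) ≡ length (filter generic-with-content-[n]? (ones ∷ []))
    coeffM-[n]≡filter-ones =
      cong (length ∘ filter generic-with-content-[n]?) (allVecs-singleton Fin.zero n)

  coeffM-[n]≡1 : IsGeneric M ones → coeffM M (n ∷ []) ≡ 1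
  coeffM-[n]≡1 generic =
    trans coeffM-[n]≡filter-ones
          (cong length (filter-accept generic-with-content-[n]? {xs = []} (content-Fin1 ones , generic)))

  coeffM-[n]≡0 : ¬ IsGeneric M ones → coeffM M (n ∷ []) ≡ 0
  coeffM-[n]≡0 ¬generic =
    trans coeffM-[n]≡filter-ones
          (cong length (filter-reject generic-with-content-[n]? {xs = []} (¬generic ∘ proj₂)))

coeffL-singleton : ∀ {n} (M : Matroid n) a → coeffL M (a ∷ []) ≡ + coeffM M (a ∷ [])
coeffL-singleton M a = trans (+-identityʳ _) (*-identityˡ _)

corollary5p6 : ∀ (n : ℕ) (M : Matroid n) →
    (SplitsCompletely M → coeffL M (n ∷ []) ≡ + 1 × coeffM M (n ∷ []) ≡ 1)
    × (¬ SplitsCompletely M → coeffL M (n ∷ []) ≡ + 0 × coeffM M (n ∷ []) ≡ 0)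
corollary5p6 n M =
    (λ split → both (coeffM-[n]≡1 M (splitsCompletely⇒isGeneric M split ones)))
  , (λ ¬split → both (coeffM-[n]≡0 M (¬split ∘ isGeneric-Fin1⇒splitsCompletely M ones)))
  where
  both : ∀ {c} → coeffM M (n ∷ []) ≡ c → coeffL M (n ∷ []) ≡ + c × coeffM M (n ∷ []) ≡ c
  both coeffM≡c = trans (coeffL-singleton M n) (cong +_ coeffM≡c) , coeffM≡c
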